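{- Let $\tau=(3,2,1)$ and let $\rho=(\rho_1,\dots,\rho_n)\in\mathcal S_n$ be arbitrary. Consider the first jump (counted from the left) in $\psi_\tau(\rho)$, and assume it occurs at position $i$, is of depth $d\ge1$, and is followed immediately by $l$ consecutive down-steps (corresponding to $\rho_{i+1},\dots,\rho_{i+l}$). Let $\rho_{i_1},\dots,\rho_{i_r}$ ($i_1<\dots<i_r\le i$) be the left-to-right maxima to the left of the jump, with heights $h_{i_1},\dots,h_{i_r}$. For each $g$, let $s_g$ be the number of down-steps to the right of the down-step of $\rho_{i_g}$ and to the left of the jump which do not correspond to left-to-right maxima (i.e. the number of positions $p$ with $i_g<p\le i$ such that $\rho_p$ is not a left-to-right maximum). Let $x$ be the smallest index for which $h_{i_x}-d-s_x>0$. Then there are exactly $$d\cdot\sum_{g=x}^{r}\min\bigl(h_{i_g}-d-s_g,\;l\bigr)$$ occurrences of $\tau$ in $\rho$ of the form $(\rho_{i_g},\rho_{i+j},\rho_k)$, where $\rho_{i_g}$ is one of the left-to-right maxima above, $\rho_{i+j}$ ($j=1,\dots,\min(h_{i_g}-d-s_g,l)$) are entries corresponding to the consecutive down-steps after the jump, and $\rho_k$ ranges over the $d$ entries of $\rho$ with $k>i$ which are smaller than $\rho_{i+1}$.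
   Context: For a permutation $\rho=(\rho_1,\dots,\rho_n)$ of $\{1,\dots,n\}$, an occurrence of the pattern $(3,2,1)$ is a subword $(\rho_a,\rho_b,\rho_c)$ with $a<b<c$ and $\rho_c<\rho_b<\rho_a$. An entry $\rho_i$ is a left-to-right maximum if $\rho_i>\rho_j$ for all $j<i$; the preceding left-to-right maximum of position $i$ is $\rho_r$ with $r\le i$ maximal such that $\rho_r$ is a left-to-right maximum. For $\tau=(3,2,1)$ the height vector is: if $\rho_i$ is a left-to-right maximum, $h_i=\#\{k>i:\rho_k<\rho_i\}$; otherwise $h_i=\#\{k>i:\rho_i<\rho_k<\rho_r\}$, where $\rho_r$ is the preceding left-to-right maximum of position $i$. The path $\psi_{(3,2,1)}(\rho)$, made of up-steps $(1,1)$, down-steps $(1,-1)$ and down-jumps $(0,-1)$, is built as follows: start at $(0,0)$; for $i=1,\dots,n$, if the current endpoint is below height $h_i+1$ append up-steps until height $h_i+1$, otherwise append down-jumps until height $h_i+1$; then append one down-step (the $i$-th down-step, corresponding to $\rho_i$, ending at height $h_i$; $h_i$ is called the height of this down-step / entry). A maximal sequence of $d\ge1$ consecutive down-jumps is a jump of depth $d$; it is at position $i$ if it lies between the $i$-th and $(i+1)$-th down-step. Consecutive down-steps means down-steps with no up-step or down-jump between them. -}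

module Defs where

open import Data.Nat.Base using (ℕ; zero; suc; _+_; _*_; _∸_; _⊓_; _≤_; _<_; _<ᵇ_; _≤ᵇ_)
open import Data.Bool.Base using (Bool; true; false; _∧_; _∨_; not; if_then_else_)
open import Data.List.Base using (List; []; _∷_; _++_; map; upTo; replicate; foldl; length)
open import Data.Nat.ListAction using (sum)
open import Relation.Nullary.Negation.Core using (¬_)
open import Data.Product.Base using (Σ; _×_; _,_)
open import Data.Sum.Base using (_⊎_)
open import Relation.Binary.PropositionalEquality using (_≡_; _≢_)

-- 1-indexed access into a list of naturals (default 0 out of range)
at : List ℕ → ℕ → ℕ
at []       _             = 0
at (x ∷ xs) zero          = 0
at (x ∷ xs) (suc zero)    = x
at (x ∷ xs) (suc (suc k)) = at xs (suc k)

positions : ℕ → List ℕ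
positions n = map suc (upTo n)

-- [x, x+1, ..., r]  (empty if r < x)
fromTo : ℕ → ℕ → List ℕ
fromTo x r = map (x +_) (upTo (suc r ∸ x))

countB : {A : Set} → (A → Bool) → List A → ℕ
countB P []       = 0
countB P (x ∷ xs) = if P x then suc (countB P xs) else countB P xs

allB : {A : Set} → (A → Bool) → List A → Bool
allB P []       = true
allB P (x ∷ xs) = P x ∧ allB P xs

anyB : {A : Set} → (A → Bool) → List A → Bool
anyB P []       = false
anyB P (x ∷ xs) = P x ∨ anyB P xs

filterB : {A : Set} → (A → Bool) → List A → List A
filterB P []       = []
filterB P (x ∷ xs) = if P x then x ∷ filterB P xs else filterB P xs

-- Permutations are lists ρ = (ρ_1,…,ρ_n); positions are 1-indexed.

module _ (ρ : List ℕ) where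

  len : ℕ
  len = length ρ

  val : ℕ → ℕ
  val p = at ρ p

  isLRMax : ℕ → Bool
  isLRMax p = allB (λ q → not (q <ᵇ p) ∨ (val q <ᵇ val p)) (positions len)

  -- value ρ_r of the preceding left-to-right maximum of position p
  -- (r ≤ p maximal with ρ_r a left-to-right maximum)
  precLRMaxVal : ℕ → ℕ
  precLRMaxVal p =
    foldl (λ acc q → if (q ≤ᵇ p) ∧ isLRMax q then val q else acc) (val p) (positions len)

  height : ℕ → ℕ
  height p =
    if isLRMax p
    then countB (λ k → (p <ᵇ k) ∧ (val k <ᵇ val p)) (positions len)
    else countB (λ k → (p <ᵇ k) ∧ (val p <ᵇ val k) ∧ (val k <ᵇ precLRMaxVal p)) (positions len)

-- Paths: up-steps (1,1), down-steps (1,-1), down-jumps (0,-1)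

data Step : Set where
  up down jump : Step

isJump : Step → Bool
isJump jump = true
isJump _    = false

moveTo : ℕ → ℕ → List Step
moveTo cur target =
  if cur <ᵇ target then replicate (target ∸ cur) up else replicate (cur ∸ target) jump

build : ℕ → List ℕ → List Step
build cur []       = []
build cur (h ∷ hs) = moveTo cur (suc h) ++ (down ∷ build h hs)

psi : List ℕ → List Step
psi ρ = build 0 (map (height ρ) (positions (len ρ)))

-- split a path at its down-steps: segment k (0-indexed) = the steps between
-- the k-th and (k+1)-th down-step (segment 0 = before the first down-step)
consHead : Step → List (List Step) → List (List Step)
consHead s []         = (s ∷ []) ∷ []
consHead s (ys ∷ yss) = (s ∷ ys) ∷ yss

splitDowns : List Step → List (List Step)
splitDowns []          = [] ∷ []
splitDowns (down ∷ xs) = [] ∷ splitDowns xs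
splitDowns (s ∷ xs)    = consHead s (splitDowns xs)

nthSeg : List (List Step) → ℕ → List Step
nthSeg []         _       = []
nthSeg (s ∷ ss)   zero    = s
nthSeg (s ∷ ss)   (suc k) = nthSeg ss k

segment : List ℕ → ℕ → List Step
segment ρ k = nthSeg (splitDowns (psi ρ)) k

lastIsJump : List Step → Bool
lastIsJump []           = false
lastIsJump (s ∷ [])     = isJump s
lastIsJump (s ∷ t ∷ ts) = lastIsJump (t ∷ ts)

headIsJump : List Step → Bool
headIsJump []      = false
headIsJump (s ∷ _) = isJump s

-- ψ(ρ) has a jump (maximal run of d ≥ 1 consecutive down-jumps) at position i,
-- i.e. between the i-th and (i+1)-th down-step
JumpAt : List ℕ → ℕ → ℕ → Set
JumpAt ρ i d =
  1 ≤ i × i < len ρ × 1 ≤ d ×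
  Σ (List Step) λ xs → Σ (List Step) λ ys →
    (segment ρ i ≡ xs ++ replicate d jump ++ ys) ×
    (lastIsJump xs ≡ false) × (headIsJump ys ≡ false)

FirstJump : List ℕ → ℕ → ℕ → Set
FirstJump ρ i d =
  JumpAt ρ i d × (∀ i′ → i′ < i → anyB isJump (segment ρ i′) ≡ false)

-- the (i+1)-th, …, (i+l)-th down-steps are consecutive (nothing between them)
-- and this run of consecutive down-steps is maximal
ConsecutiveAfter : List ℕ → ℕ → ℕ → Set
ConsecutiveAfter ρ i l =
  1 ≤ l × i + l ≤ len ρ ×
  (∀ k → i < k → k < i + l → segment ρ k ≡ []) ×
  (i + l ≡ len ρ ⊎ segment ρ (i + l) ≢ [])

module _ (ρ : List ℕ) (i d l : ℕ) where

  lrMaxima : List ℕ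
  lrMaxima = filterB (isLRMax ρ) (positions i)

  r : ℕ
  r = length lrMaxima

  ix : ℕ → ℕ
  ix g = at lrMaxima g

  s : ℕ → ℕ
  s g = countB (λ p → (ix g <ᵇ p) ∧ not (isLRMax ρ p)) (positions i)

  Positive : ℕ → Set
  Positive g = d + s g < height ρ (ix g)

  bound : ℕ → ℕ
  bound g = (height ρ (ix g) ∸ d ∸ s g) ⊓ l

  IsSmallestPositive : ℕ → Set
  IsSmallestPositive x =
    1 ≤ x × x ≤ r × Positive x × (∀ g → 1 ≤ g → g < x → ¬ Positive g)

  isOcc321 : ℕ → ℕ → ℕ → Bool
  isOcc321 a b c = (a <ᵇ b) ∧ (b <ᵇ c) ∧ (val ρ c <ᵇ val ρ b) ∧ (val ρ b <ᵇ val ρ a)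

  formOccurrences : ℕ → ℕ
  formOccurrences x =
    sum (map (λ g →
      sum (map (λ b →
        countB (λ k →
          (i <ᵇ b) ∧ (b ≤ᵇ i + bound g) ∧ (i <ᵇ k) ∧ (val ρ k <ᵇ val ρ (suc i))
          ∧ isOcc321 (ix g) b k)
          (positions (len ρ)))
        (positions (len ρ))))
      (fromTo x r))

{-# OPTIONS --safe #-}
module Submission where

-- Write h_p for the height of position p.  The path ψ(ρ) records the differences of consecutive
-- heights: the jump gives h_i = h_{i+1} + 1 + d, the absence of earlier jumps gives
-- h_p ≤ h_{p+1} + 1 for p < i, and the run of consecutive down-steps gives h_b = h_{b+1} + 1.
-- Comparing the sets counted by h_p and h_{p+1} (the first is the second plus position p+1 plus a
-- "gap" set of later values between ρ_p and ρ_{p+1}) turns these into statements about ρ: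
-- ρ_{i+1} is not a left-to-right maximum and exactly d later entries are smaller than it; the run
-- ρ_{i+1} < … < ρ_{i+l} increases with no later value in between, so exactly d + (b - i - 1)
-- entries after position i are smaller than ρ_b; and every entry up to i that is not a
-- left-to-right maximum is smaller than every entry after i.  Consequently ρ_b < ρ_{i_g} for
-- i < b ≤ i + min(h_{i_g} - d - s_g, l): otherwise the h_{i_g} entries after i_g smaller than
-- ρ_{i_g} would number at most s_g + d + (b - i - 1) < h_{i_g}.  Hence for each such g and b the
-- occurrences (ρ_{i_g}, ρ_b, ρ_k) are exactly those with ρ_k one of the d entries after i smaller
-- than ρ_{i+1}.

open import Defs
open import Data.Bool.Base using (Bool; true; false; _∧_; _∨_; not; if_then_else_; T)
open import Data.Bool.Properties using (T-∧; T-∨; T-≡; T-not-≡; T?)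
open import Data.Empty using (⊥; ⊥-elim)
open import Data.List.Base using (List; []; _∷_; _++_; [_]; map; upTo; applyUpTo; replicate; foldl; length)
open import Data.List.Properties
  using (map-upTo; map-applyUpTo; map-cong-local; foldl-++; upTo-∷ʳ; map-++; length-replicate; ++-identityʳ)
open import Data.List.Membership.Propositional using (_∈_)
open import Data.List.Membership.Propositional.Properties using (∈-map⁺; ∈-map⁻; ∈-upTo⁺; ∈-upTo⁻)
open import Data.List.Relation.Binary.Permutation.Propositional using (_↭_; ↭⇒↭ₛ; ↭-sym)
open import Data.List.Relation.Binary.Permutation.Setoid.Properties using (Unique-resp-↭)
open import Data.List.Relation.Unary.All as All using (All; []; _∷_)
open import Data.List.Relation.Unary.All.Properties using (++⁻ˡ; ++⁻ʳ; replicate⁺; replicate⁻)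
open import Data.List.Relation.Unary.AllPairs using (_∷_)
open import Data.List.Relation.Unary.Any using (here; there)
open import Data.List.Relation.Unary.Unique.Propositional using (Unique)
import Data.List.Relation.Unary.Unique.Propositional.Properties as Unique
open import Data.Nat.Base
open import Data.Nat.ListAction using (sum)
open import Data.Nat.Properties
open import Data.Nat.Tactic.RingSolver using (solve-∀)
open import Data.Product.Base using (∃; _×_; _,_; proj₁; proj₂; map₁)
open import Data.Sum.Base using (_⊎_; inj₁; inj₂; [_,_]′)
open import Function.Base using (_∘_; id; case_of_)
open import Function.Bundles using (Equivalence)
open import Relation.Binary.Definitions using (tri<; tri≈; tri>)
open import Relation.Binary.PropositionalEquality hiding ([_])
open import Relation.Nullary.Decidable.Core using (yes; no)
open import Relation.Nullary.Negation.Core using (¬_)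

open Equivalence using (to; from)

if-T : ∀ {A : Set} {b} {x y : A} → T b → (if b then x else y) ≡ x
if-T {b = true} _ = refl

if-¬T : ∀ {A : Set} {b} {x y : A} → ¬ T b → (if b then x else y) ≡ y
if-¬T {b = true}  ¬b = ⊥-elim (¬b _)
if-¬T {b = false} _  = refl

if-T∧ : ∀ {A : Set} {a b} {x y : A} → T a → (if a ∧ b then x else y) ≡ (if b then x else y)
if-T∧ {a = true} _ = refl

infixr 5 _∧ᵀ_
_∧ᵀ_ : ∀ {a b} → T a → T b → T (a ∧ b)
p ∧ᵀ q = T-∧ .from (p , q)

¬T⇒≡false : ∀ {b} → ¬ T b → b ≡ false
¬T⇒≡false {true}  ¬t = ⊥-elim (¬t _)
¬T⇒≡false {false} _  = refl

¬T-not⇒T : ∀ {b} → ¬ T (not b) → T b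
¬T-not⇒T {true}  _  = _
¬T-not⇒T {false} ¬t = ¬t _

module _ {A : Set} where

  countB-mono : ∀ {P Q : A → Bool} xs → (∀ {k} → k ∈ xs → T (P k) → T (Q k)) →
                countB P xs ≤ countB Q xs
  countB-mono             []       _   = z≤n
  countB-mono {P} {Q} (x ∷ xs) P⇒Q with P x in Px | Q x in Qx
  ... | false | false = countB-mono xs (P⇒Q ∘ there)
  ... | false | true  = m≤n⇒m≤1+n (countB-mono xs (P⇒Q ∘ there))
  ... | true  | true  = s≤s (countB-mono xs (P⇒Q ∘ there))
  ... | true  | false = ⊥-elim (subst T Qx (P⇒Q (here refl) (T-≡ .from Px)))

  countB-cong : ∀ {P Q : A → Bool} xs → (∀ {k} → k ∈ xs → T (P k) → T (Q k)) →
                (∀ {k} → k ∈ xs → T (Q k) → T (P k)) → countB P xs ≡ countB Q xs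
  countB-cong xs P⇒Q Q⇒P = ≤-antisym (countB-mono xs P⇒Q) (countB-mono xs Q⇒P)

  countB-≡0 : ∀ {P : A → Bool} xs → (∀ {k} → k ∈ xs → ¬ T (P k)) → countB P xs ≡ 0
  countB-≡0     []       _  = refl
  countB-≡0 {P} (x ∷ xs) ¬P with P x in Px
  ... | false = countB-≡0 xs (¬P ∘ there)
  ... | true  = ⊥-elim (¬P (here refl) (T-≡ .from Px))

  countB-pos : ∀ {P : A → Bool} {k} xs → k ∈ xs → T (P k) → 0 < countB P xs
  countB-pos {P} (x ∷ xs) k∈ Pk with P x in Px
  ... | true = z<s
  countB-pos (x ∷ xs) (here refl) Pk | false = ⊥-elim (subst T Px Pk)
  countB-pos (x ∷ xs) (there k∈)  Pk | false = countB-pos xs k∈ Pk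

  countB-∨ : ∀ {P Q : A → Bool} xs → (∀ {k} → T (P k) → ¬ T (Q k)) →
             countB (λ k → P k ∨ Q k) xs ≡ countB P xs + countB Q xs
  countB-∨         []       _        = refl
  countB-∨ {P} {Q} (x ∷ xs) disjoint with P x in Px | Q x in Qx
  ... | true  | true  = ⊥-elim (disjoint (T-≡ .from Px) (T-≡ .from Qx))
  ... | true  | false = cong suc (countB-∨ xs disjoint)
  ... | false | true  = trans (cong suc (countB-∨ xs disjoint)) (sym (+-suc _ _))
  ... | false | false = countB-∨ xs disjoint

  countB-++ : ∀ (P : A → Bool) xs ys → countB P (xs ++ ys) ≡ countB P xs + countB P ys
  countB-++ P []       ys = refl
  countB-++ P (x ∷ xs) ys with P x
  ... | true  = cong suc (countB-++ P xs ys)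
  ... | false = countB-++ P xs ys

countB-≡ᵇ : ∀ {m xs} → Unique xs → m ∈ xs → countB (_≡ᵇ m) xs ≡ 1
countB-≡ᵇ {m} {x ∷ xs} (x∉xs ∷ unique) m∈ with x ≡ᵇ m in x≡ᵇm
... | true = cong suc (countB-≡0 xs λ {k} k∈ k≡ᵇm →
               All.lookup x∉xs k∈ (trans (≡ᵇ⇒≡ x m (T-≡ .from x≡ᵇm)) (sym (≡ᵇ⇒≡ k m k≡ᵇm))))
countB-≡ᵇ {m} {x ∷ xs} _            (here m≡x) | false = ⊥-elim (subst T x≡ᵇm (≡⇒≡ᵇ x m (sym m≡x)))
countB-≡ᵇ {m} {x ∷ xs} (_ ∷ unique) (there m∈) | false = countB-≡ᵇ unique m∈

countB-insert : ∀ {P Q : ℕ → Bool} {m xs} → Unique xs → m ∈ xs → T (P m) →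
                (∀ {k} → k ∈ xs → T (P k) → k ≡ m ⊎ T (Q k)) →
                (∀ {k} → T (Q k) → T (P k) × k ≢ m) →
                countB P xs ≡ suc (countB Q xs)
countB-insert {P} {Q} {m} {xs} unique m∈ Pm split Q⇒P = begin
  countB P xs                        ≡⟨ countB-cong xs P⇒ ⇒P ⟩
  countB (λ k → (k ≡ᵇ m) ∨ Q k) xs   ≡⟨ countB-∨ xs (λ {k} k≡ᵇm Qk → proj₂ (Q⇒P Qk) (≡ᵇ⇒≡ k m k≡ᵇm)) ⟩
  countB (_≡ᵇ m) xs + countB Q xs    ≡⟨ cong (_+ countB Q xs) (countB-≡ᵇ unique m∈) ⟩
  suc (countB Q xs)                  ∎
  where
  open ≡-Reasoning
  P⇒ : ∀ {k} → k ∈ xs → T (P k) → T ((k ≡ᵇ m) ∨ Q k)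
  P⇒ {k} k∈ Pk = T-∨ .from ([ (λ k≡m → inj₁ (≡⇒≡ᵇ k m k≡m)) , inj₂ ]′ (split k∈ Pk))
  ⇒P : ∀ {k} → k ∈ xs → T ((k ≡ᵇ m) ∨ Q k) → T (P k)
  ⇒P {k} _ t = [ (λ k≡ᵇm → subst (T ∘ P) (sym (≡ᵇ⇒≡ k m k≡ᵇm)) Pm) , proj₁ ∘ Q⇒P ]′ (T-∨ .to t)

module _ {A : Set} {P : A → Bool} where

  allB⁻ : ∀ {xs k} → T (allB P xs) → k ∈ xs → T (P k)
  allB⁻ {x ∷ xs} t (here refl) = proj₁ (T-∧ .to t)
  allB⁻ {x ∷ xs} t (there k∈)  = allB⁻ (proj₂ (T-∧ .to t)) k∈

  allB⁺ : ∀ {xs} → (∀ {k} → k ∈ xs → T (P k)) → T (allB P xs)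
  allB⁺ {[]}     _   = _
  allB⁺ {x ∷ xs} all = all (here refl) ∧ᵀ allB⁺ (all ∘ there)

  ¬allB⁻ : ∀ {xs} → ¬ T (allB P xs) → ∃ λ k → k ∈ xs × ¬ T (P k)
  ¬allB⁻ {[]}     ¬all = ⊥-elim (¬all _)
  ¬allB⁻ {x ∷ xs} ¬all with T? (P x)
  ... | no ¬Px = x , here refl , ¬Px
  ... | yes Px with k , k∈ , ¬Pk ← ¬allB⁻ (λ all → ¬all (Px ∧ᵀ all)) = k , there k∈ , ¬Pk

  filterB⁻ : ∀ xs {k} → k ∈ filterB P xs → k ∈ xs × T (P k)
  filterB⁻ (x ∷ xs) k∈ with P x in Px
  filterB⁻ (x ∷ xs) (here refl) | true  = here refl , T-≡ .from Px
  filterB⁻ (x ∷ xs) (there k∈)  | true  = map₁ there (filterB⁻ xs k∈)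
  filterB⁻ (x ∷ xs) k∈          | false = map₁ there (filterB⁻ xs k∈)

positions-suc : ∀ n → positions (suc n) ≡ positions n ++ [ suc n ]
positions-suc n = trans (cong (map suc) (sym (upTo-∷ʳ n))) (map-++ suc (upTo n) [ n ])

∈-positions⁺ : ∀ {n k} → 1 ≤ k → k ≤ n → k ∈ positions n
∈-positions⁺ {k = suc k} _ k<n = ∈-map⁺ suc (∈-upTo⁺ k<n)

∈-positions⁻ : ∀ {n k} → k ∈ positions n → 1 ≤ k × k ≤ n
∈-positions⁻ k∈ with _ , k∈upTo , refl ← ∈-map⁻ suc k∈ = s≤s z≤n , ∈-upTo⁻ k∈upTo

positions-unique : ∀ n → Unique (positions n)
positions-unique n = Unique.map⁺ suc-injective (Unique.upTo⁺ n)

foldl-positions-suc : ∀ {A : Set} (f : A → ℕ → A) a m →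
                      foldl f a (positions (suc m)) ≡ f (foldl f a (positions m)) (suc m)
foldl-positions-suc f a m = trans (cong (foldl f a) (positions-suc m)) (foldl-++ f a (positions m) [ suc m ])

countB-positions-+ : ∀ {P : ℕ → Bool} m i → (∀ {k} → T (P k) → k ≤ i) →
                     countB P (positions (m + i)) ≡ countB P (positions i)
countB-positions-+     zero    i _   = refl
countB-positions-+ {P} (suc m) i P≤i = begin
  countB P (positions (suc (m + i)))                        ≡⟨ cong (countB P) (positions-suc (m + i)) ⟩
  countB P (positions (m + i) ++ [ suc (m + i) ])           ≡⟨ countB-++ P (positions (m + i)) _ ⟩
  countB P (positions (m + i)) + countB P [ suc (m + i) ]   ≡⟨ cong₂ _+_ (countB-positions-+ m i P≤i) last≡0 ⟩
  countB P (positions i) + 0                                ≡⟨ +-identityʳ _ ⟩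
  countB P (positions i)                                    ∎
  where
  open ≡-Reasoning
  last≡0 : countB P [ suc (m + i) ] ≡ 0
  last≡0 = countB-≡0 {P = P} [ _ ] λ { (here refl) Pk → 1+n≰n (≤-trans (P≤i Pk) (m≤n+m i m)) }

countB-positions-∧≤ : ∀ (P : ℕ → Bool) {i N} → i ≤ N →
                      countB (λ k → P k ∧ (k ≤ᵇ i)) (positions N) ≡ countB P (positions i)
countB-positions-∧≤ P {i} {N} i≤N = begin
  countB P≤i (positions N)            ≡⟨ cong (countB P≤i ∘ positions) (sym (m∸n+n≡m i≤N)) ⟩
  countB P≤i (positions (N ∸ i + i))  ≡⟨ countB-positions-+ (N ∸ i) i (λ {k} t → ≤ᵇ⇒≤ k i (proj₂ (T-∧ .to t))) ⟩
  countB P≤i (positions i)            ≡⟨ countB-cong (positions i) (λ _ → proj₁ ∘ T-∧ .to)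
                                           (λ k∈ Pk → Pk ∧ᵀ ≤⇒≤ᵇ (proj₂ (∈-positions⁻ k∈))) ⟩
  countB P (positions i)              ∎
  where
  open ≡-Reasoning
  P≤i = λ k → P k ∧ (k ≤ᵇ i)

countB-interval : ∀ {N} i m → i + m ≤ N → countB (λ b → (i <ᵇ b) ∧ (b ≤ᵇ i + m)) (positions N) ≡ m
countB-interval {N} i zero _ = countB-≡0 (positions N) λ {b} _ t →
  let i<b , b≤i+0 = T-∧ .to t in <⇒≱ (<ᵇ⇒< i b i<b) (subst (b ≤_) (+-identityʳ i) (≤ᵇ⇒≤ b (i + 0) b≤i+0))
countB-interval {N} i (suc m) i+1+m≤N = trans
  (countB-insert (positions-unique N) (∈-positions⁺ (≤-trans (s≤s z≤n) i<top) i+1+m≤N)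
                 (<⇒<ᵇ i<top ∧ᵀ ≤⇒≤ᵇ (≤-refl {top})) split shrink)
  (cong suc (countB-interval i m (≤-trans (+-monoʳ-≤ i (n≤1+n m)) i+1+m≤N)))
  where
  top = i + suc m
  i<top : i < top
  i<top = ≤-trans (s≤s (m≤m+n i m)) (≤-reflexive (sym (+-suc i m)))
  split : ∀ {b} → b ∈ positions N → T ((i <ᵇ b) ∧ (b ≤ᵇ top)) → b ≡ top ⊎ T ((i <ᵇ b) ∧ (b ≤ᵇ i + m))
  split {b} _ t with i<b , b≤top ← T-∧ .to t | b ≤? i + m
  ... | yes b≤i+m = inj₂ (i<b ∧ᵀ ≤⇒≤ᵇ b≤i+m)
  ... | no  b≰i+m = inj₁ (≤-antisym (≤ᵇ⇒≤ b top b≤top) (subst (_≤ b) (sym (+-suc i m)) (≰⇒> b≰i+m)))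
  shrink : ∀ {b} → T ((i <ᵇ b) ∧ (b ≤ᵇ i + m)) → T ((i <ᵇ b) ∧ (b ≤ᵇ top)) × b ≢ top
  shrink {b} t with i<b , b≤ᵇi+m ← T-∧ .to t =
    i<b ∧ᵀ ≤⇒≤ᵇ (≤-trans b≤i+m (+-monoʳ-≤ i (n≤1+n m))) , λ { refl → 1+n≰n (subst (_≤ i + m) (+-suc i m) b≤i+m) }
    where b≤i+m = ≤ᵇ⇒≤ b (i + m) b≤ᵇi+m

at-∈ : ∀ (xs : List ℕ) {p} → 1 ≤ p → p ≤ length xs → at xs p ∈ xs
at-∈ (x ∷ xs) {suc zero}    _ _        = here refl
at-∈ (x ∷ xs) {suc (suc p)} _ (s≤s p<) = there (at-∈ xs (s≤s z≤n) p<)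

at-injective : ∀ {xs} → Unique xs → ∀ {p q} → 1 ≤ p → p ≤ length xs → 1 ≤ q → q ≤ length xs →
               at xs p ≡ at xs q → p ≡ q
at-injective {x ∷ xs} _ {suc zero} {suc zero} _ _ _ _ _ = refl
at-injective {x ∷ xs} (x∉xs ∷ _) {suc zero} {suc (suc q)} _ _ _ (s≤s q<) x≡ =
  ⊥-elim (All.lookup x∉xs (at-∈ xs (s≤s z≤n) q<) x≡)
at-injective {x ∷ xs} (x∉xs ∷ _) {suc (suc p)} {suc zero} _ (s≤s p<) _ _ ≡x =
  ⊥-elim (All.lookup x∉xs (at-∈ xs (s≤s z≤n) p<) (sym ≡x))
at-injective {x ∷ xs} (_ ∷ unique) {suc (suc p)} {suc (suc q)} _ (s≤s p<) _ (s≤s q<) eq =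
  cong suc (at-injective unique (s≤s z≤n) p< (s≤s z≤n) q< eq)

fromTo⁻ : ∀ {x r g} → g ∈ fromTo x r → x ≤ g × g ≤ r
fromTo⁻ {x} {r} g∈ with t , t∈ , refl ← ∈-map⁻ (x +_) g∈ = m≤m+n x t , ≤-pred (begin
  suc (x + t)   ≡⟨ cong suc (+-comm x t) ⟩
  suc t + x     ≤⟨ m≤o∸n⇒m+n≤o (suc t) x≤1+r (∈-upTo⁻ t∈) ⟩
  suc r         ∎)
  where
  open ≤-Reasoning
  x≤1+r : x ≤ suc r
  x≤1+r = <⇒≤ (m∸n≢0⇒n<m λ empty → n≮0 (subst (t <_) empty (∈-upTo⁻ t∈)))

sum-map-cong : ∀ {A : Set} {f g : A → ℕ} xs → (∀ {k} → k ∈ xs → f k ≡ g k) → sum (map f xs) ≡ sum (map g xs)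
sum-map-cong xs f≡g = cong sum (map-cong-local (All.tabulate f≡g))

sum-map-*ˡ : ∀ {A : Set} c (f : A → ℕ) xs → sum (map (λ k → c * f k) xs) ≡ c * sum (map f xs)
sum-map-*ˡ c f []       = sym (*-zeroʳ c)
sum-map-*ˡ c f (x ∷ xs) = trans (cong (c * f x +_) (sum-map-*ˡ c f xs)) (sym (*-distribˡ-+ c (f x) _))

sum-map-indicator : ∀ {A : Set} c (Q : A → Bool) xs → sum (map (λ k → if Q k then c else 0) xs) ≡ c * countB Q xs
sum-map-indicator c Q []       = sym (*-zeroʳ c)
sum-map-indicator c Q (x ∷ xs) with Q x
... | true  = trans (cong (c +_) (sum-map-indicator c Q xs)) (sym (*-suc c _))
... | false = sum-map-indicator c Q xs

splitDowns-replicate : ∀ s m rest → s ≢ down →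
                       splitDowns (replicate m s ++ down ∷ rest) ≡ replicate m s ∷ splitDowns rest
splitDowns-replicate s    zero    rest _  = refl
splitDowns-replicate up   (suc m) rest ne = cong (consHead up) (splitDowns-replicate up m rest ne)
splitDowns-replicate jump (suc m) rest ne = cong (consHead jump) (splitDowns-replicate jump m rest ne)
splitDowns-replicate down (suc m) rest ne = ⊥-elim (ne refl)

splitDowns-moveTo : ∀ a t rest → splitDowns (moveTo a t ++ down ∷ rest) ≡ moveTo a t ∷ splitDowns rest
splitDowns-moveTo a t rest with a <ᵇ t
... | true  = splitDowns-replicate up (t ∸ a) rest (λ ())
... | false = splitDowns-replicate jump (a ∸ t) rest (λ ())

nthSeg-build : ∀ cur (f : ℕ → ℕ) n k → suc k < n →
               nthSeg (splitDowns (build cur (applyUpTo f n))) (suc k) ≡ moveTo (f k) (suc (f (suc k)))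
nthSeg-build cur f (suc zero) zero (s≤s ())
nthSeg-build cur f (suc (suc n)) zero _
  rewrite splitDowns-moveTo cur (suc (f 0)) (build (f 0) (applyUpTo (f ∘ suc) (suc n)))
        | splitDowns-moveTo (f 0) (suc (f 1)) (build (f 1) (applyUpTo (f ∘ suc ∘ suc) n)) = refl
nthSeg-build cur f (suc (suc n)) (suc k) (s≤s k<n)
  rewrite splitDowns-moveTo cur (suc (f 0)) (build (f 0) (applyUpTo (f ∘ suc) (suc n))) =
  nthSeg-build (f 0) (f ∘ suc) (suc n) k k<n

segment-height : ∀ ρ {k} → 1 ≤ k → k < len ρ → segment ρ k ≡ moveTo (height ρ k) (suc (height ρ (suc k)))
segment-height ρ {suc k} _ k<N = begin
  nthSeg (splitDowns (build 0 (map (height ρ) (map suc (upTo N))))) (suc k)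
    ≡⟨ cong (λ hs → nthSeg (splitDowns (build 0 hs)) (suc k)) heights ⟩
  nthSeg (splitDowns (build 0 (applyUpTo (height ρ ∘ suc) N))) (suc k)
    ≡⟨ nthSeg-build 0 (height ρ ∘ suc) N k k<N ⟩
  moveTo (height ρ (suc k)) (suc (height ρ (suc (suc k)))) ∎
  where
  open ≡-Reasoning
  N = len ρ
  heights : map (height ρ) (map suc (upTo N)) ≡ applyUpTo (height ρ ∘ suc) N
  heights = trans (cong (map (height ρ)) (map-upTo suc N)) (map-applyUpTo suc (height ρ) N)

moveTo-< : ∀ {a t} → a < t → moveTo a t ≡ replicate (t ∸ a) up
moveTo-< {a} {t} a<t with a <ᵇ t | <⇒<ᵇ a<t
... | true | _ = refl

moveTo-≮ : ∀ {a t} → ¬ a < t → moveTo a t ≡ replicate (a ∸ t) jump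
moveTo-≮ {a} {t} a≮t with a <ᵇ t in a<ᵇt
... | true  = ⊥-elim (a≮t (<ᵇ⇒< a t (T-≡ .from a<ᵇt)))
... | false = refl

replicate-≡[] : ∀ {m} {s : Step} → replicate m s ≡ [] → m ≡ 0
replicate-≡[] {zero} _ = refl

anyJump-replicate : ∀ m → anyB isJump (replicate m jump) ≡ false → m ≡ 0
anyJump-replicate zero _ = refl

allJump-lastIsJump : ∀ {xs} → All (_≡ jump) xs → lastIsJump xs ≡ false → xs ≡ []
allJump-lastIsJump []                   _ = refl
allJump-lastIsJump (refl ∷ [])          ()
allJump-lastIsJump (refl ∷ all@(_ ∷ _)) e with () ← allJump-lastIsJump all e

allJump-headIsJump : ∀ {ys} → All (_≡ jump) ys → headIsJump ys ≡ false → ys ≡ []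
allJump-headIsJump []         _  = refl
allJump-headIsJump (refl ∷ _) ()

moveTo-jump : ∀ {a t d xs ys} → 1 ≤ d → moveTo a t ≡ xs ++ replicate d jump ++ ys →
              lastIsJump xs ≡ false → headIsJump ys ≡ false → a ≡ t + d
moveTo-jump {a} {t} {suc d} {xs} {ys} _ steps last head with a <? t
... | yes a<t with () ← replicate⁻ (++⁻ˡ (replicate (suc d) jump) (++⁻ʳ xs
                          (subst (All (_≡ up)) (trans (sym (moveTo-< a<t)) steps) (replicate⁺ (t ∸ a) refl))))
... | no a≮t = begin
  a            ≡⟨ sym (m+[n∸m]≡n (≮⇒≥ a≮t)) ⟩
  t + (a ∸ t)  ≡⟨ cong (t +_) depth ⟩
  t + suc d    ∎
  where
  open ≡-Reasoning
  allJump : All (_≡ jump) (xs ++ replicate (suc d) jump ++ ys)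
  allJump = subst (All (_≡ jump)) (trans (sym (moveTo-≮ a≮t)) steps) (replicate⁺ (a ∸ t) refl)
  xs≡[] : xs ≡ []
  xs≡[] = allJump-lastIsJump (++⁻ˡ xs allJump) last
  ys≡[] : ys ≡ []
  ys≡[] = allJump-headIsJump (++⁻ʳ (replicate (suc d) jump) (++⁻ʳ xs allJump)) head
  depth : a ∸ t ≡ suc d
  depth = begin
    a ∸ t                                        ≡⟨ sym (length-replicate (a ∸ t)) ⟩
    length (replicate (a ∸ t) jump)              ≡⟨ cong length (trans (sym (moveTo-≮ a≮t)) steps) ⟩
    length (xs ++ replicate (suc d) jump ++ ys)  ≡⟨ cong₂ (λ xs ys → length (xs ++ replicate (suc d) jump ++ ys)) xs≡[] ys≡[] ⟩
    length (replicate (suc d) jump ++ [])        ≡⟨ cong length (++-identityʳ (replicate (suc d) jump)) ⟩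
    length (replicate (suc d) jump)              ≡⟨ length-replicate (suc d) ⟩
    suc d                                        ∎

moveTo-noJump : ∀ {a t} → anyB isJump (moveTo a t) ≡ false → a ≤ t
moveTo-noJump {a} {t} noJump with a <? t
... | yes a<t = <⇒≤ a<t
... | no  a≮t = m∸n≡0⇒m≤n (anyJump-replicate (a ∸ t) (subst (λ s → anyB isJump s ≡ false) (moveTo-≮ a≮t) noJump))

moveTo-[] : ∀ {a t} → moveTo a t ≡ [] → a ≡ t
moveTo-[] {a} {t} empty with a <? t
... | yes a<t = ⊥-elim (<⇒≱ a<t (m∸n≡0⇒m≤n (replicate-≡[] (trans (sym (moveTo-< a<t)) empty))))
... | no  a≮t = ≤-antisym (m∸n≡0⇒m≤n (replicate-≡[] (trans (sym (moveTo-≮ a≮t)) empty))) (≮⇒≥ a≮t)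

JumpAt⇒height : ∀ ρ {i d} → JumpAt ρ i d → height ρ i ≡ suc (height ρ (suc i)) + d
JumpAt⇒height ρ (1≤i , i<N , 1≤d , xs , ys , segment≡ , last , head) =
  moveTo-jump {xs = xs} {ys} 1≤d (trans (sym (segment-height ρ 1≤i i<N)) segment≡) last head

noJump⇒height-≤ : ∀ ρ {p} → 1 ≤ p → p < len ρ → anyB isJump (segment ρ p) ≡ false →
                  height ρ p ≤ suc (height ρ (suc p))
noJump⇒height-≤ ρ 1≤p p<N noJump =
  moveTo-noJump (subst (λ s → anyB isJump s ≡ false) (segment-height ρ 1≤p p<N) noJump)

emptySegment⇒height : ∀ ρ {k} → 1 ≤ k → k < len ρ → segment ρ k ≡ [] → height ρ k ≡ suc (height ρ (suc k))
emptySegment⇒height ρ 1≤k k<N empty = moveTo-[] (trans (sym (segment-height ρ 1≤k k<N)) empty)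

permutation-unique : ∀ {n} {ρ : List ℕ} → ρ ↭ map suc (upTo n) → Unique ρ
permutation-unique {n} ρ↭ = Unique-resp-↭ (setoid ℕ) (↭⇒↭ₛ (↭-sym ρ↭)) (positions-unique n)

module Entries (ρ : List ℕ) (ρ-unique : Unique ρ) where

  N : ℕ
  N = len ρ

  v : ℕ → ℕ
  v = val ρ

  LR : ℕ → Bool
  LR = isLRMax ρ

  Mx : ℕ → ℕ
  Mx = precLRMaxVal ρ

  H : ℕ → ℕ
  H = height ρ

  val-injective : ∀ {p q} → 1 ≤ p → p ≤ N → 1 ≤ q → q ≤ N → v p ≡ v q → p ≡ q
  val-injective = at-injective ρ-unique

  val-<⊎> : ∀ {p q} → 1 ≤ p → p ≤ N → 1 ≤ q → q ≤ N → p ≢ q → v p < v q ⊎ v q < v p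
  val-<⊎> {p} {q} 1≤p p≤N 1≤q q≤N p≢q with <-cmp (v p) (v q)
  ... | tri< vp<vq _ _ = inj₁ vp<vq
  ... | tri≈ _ vp≡vq _ = ⊥-elim (p≢q (val-injective 1≤p p≤N 1≤q q≤N vp≡vq))
  ... | tri> _ _ vq<vp = inj₂ vq<vp

  val-≮⇒> : ∀ {p q} → 1 ≤ p → p ≤ N → 1 ≤ q → q ≤ N → p ≢ q → ¬ v q < v p → v p < v q
  val-≮⇒> 1≤p p≤N 1≤q q≤N p≢q vq≮vp = [ id , ⊥-elim ∘ vq≮vp ]′ (val-<⊎> 1≤p p≤N 1≤q q≤N p≢q)

  isLRMax⇒< : ∀ {p q} → p ≤ N → T (LR p) → 1 ≤ q → q < p → v q < v p
  isLRMax⇒< {p} {q} p≤N lr 1≤q q<p with T-∨ .to (allB⁻ lr (∈-positions⁺ 1≤q (<⇒≤ (<-≤-trans q<p p≤N))))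
  ... | inj₁ q≮ᵇp = ⊥-elim (subst T (T-not-≡ .to q≮ᵇp) (<⇒<ᵇ q<p))
  ... | inj₂ vq<ᵇvp = <ᵇ⇒< (v q) (v p) vq<ᵇvp

  ¬isLRMax⇒> : ∀ {p} → 1 ≤ p → p ≤ N → ¬ T (LR p) → ∃ λ q → 1 ≤ q × q < p × v p < v q
  ¬isLRMax⇒> {p} 1≤p p≤N ¬lr with q , q∈ , ¬ok ← ¬allB⁻ {P = λ q → not (q <ᵇ p) ∨ (v q <ᵇ v p)} ¬lr =
    q , 1≤q , q<p , ≤∧≢⇒< vp≤vq (λ vp≡vq → <⇒≢ q<p (sym (val-injective 1≤p p≤N 1≤q q≤N vp≡vq)))
    where
    1≤q = proj₁ (∈-positions⁻ q∈)
    q≤N = proj₂ (∈-positions⁻ q∈)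
    q<p : q < p
    q<p = <ᵇ⇒< q p (¬T-not⇒T (¬ok ∘ T-∨ .from ∘ inj₁))
    vp≤vq : v p ≤ v q
    vp≤vq = ≮⇒≥ (¬ok ∘ T-∨ .from ∘ inj₂ ∘ <⇒<ᵇ)

  isLRMax-1 : T (LR 1)
  isLRMax-1 = allB⁺ {xs = positions N} (first-ok ∘ proj₁ ∘ ∈-positions⁻)
    where
    first-ok : ∀ {q} → 1 ≤ q → T (not (q <ᵇ 1) ∨ (v q <ᵇ v 1))
    first-ok {suc q} _ = _

  precLRMaxUpTo : ℕ → ℕ → ℕ
  precLRMaxUpTo p m = foldl (λ acc q → if (q ≤ᵇ p) ∧ LR q then v q else acc) (v p) (positions m)

  precLRMaxUpTo-suc : ∀ {p m} → suc m ≤ p →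
                      precLRMaxUpTo p (suc m) ≡ (if LR (suc m) then v (suc m) else precLRMaxUpTo p m)
  precLRMaxUpTo-suc {p} {m} sm≤p = trans (foldl-positions-suc _ (v p) m) (if-T∧ (≤⇒≤ᵇ sm≤p))

  precLRMaxUpTo-beyond : ∀ p m → precLRMaxUpTo p (m + p) ≡ precLRMaxUpTo p p
  precLRMaxUpTo-beyond p zero    = refl
  precLRMaxUpTo-beyond p (suc m) = trans (foldl-positions-suc _ (v p) (m + p))
    (trans (if-¬T (λ t → 1+n≰n (≤-trans (≤ᵇ⇒≤ _ p (proj₁ (T-∧ .to t))) (m≤n+m p m))))
           (precLRMaxUpTo-beyond p m))

  precLRMax≡upTo : ∀ {p} → p ≤ N → Mx p ≡ precLRMaxUpTo p p
  precLRMax≡upTo {p} p≤N = trans (cong (precLRMaxUpTo p) (sym (m∸n+n≡m p≤N))) (precLRMaxUpTo-beyond p (N ∸ p))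

  -- The initial accumulator v p is overwritten at position 1, which is always a left-to-right maximum.
  precLRMaxUpTo-irrelevant : ∀ {p p′} m → 1 ≤ m → m ≤ p → m ≤ p′ → precLRMaxUpTo p m ≡ precLRMaxUpTo p′ m
  precLRMaxUpTo-irrelevant (suc zero) _ 1≤p 1≤p′ =
    trans (precLRMaxUpTo-suc 1≤p) (trans (if-T isLRMax-1) (sym (trans (precLRMaxUpTo-suc 1≤p′) (if-T isLRMax-1))))
  precLRMaxUpTo-irrelevant (suc (suc m)) _ m≤p m≤p′ = begin
    precLRMaxUpTo _ (suc (suc m))                                 ≡⟨ precLRMaxUpTo-suc m≤p ⟩
    (if LR (suc (suc m)) then v (suc (suc m)) else precLRMaxUpTo _ (suc m))
      ≡⟨ cong (if LR (suc (suc m)) then v (suc (suc m)) else_)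
              (precLRMaxUpTo-irrelevant (suc m) (s≤s z≤n) (<⇒≤ m≤p) (<⇒≤ m≤p′)) ⟩
    (if LR (suc (suc m)) then v (suc (suc m)) else precLRMaxUpTo _ (suc m))
      ≡⟨ sym (precLRMaxUpTo-suc m≤p′) ⟩
    precLRMaxUpTo _ (suc (suc m))                                 ∎
    where open ≡-Reasoning

  precLRMax-LR : ∀ {p} → 1 ≤ p → p ≤ N → T (LR p) → Mx p ≡ v p
  precLRMax-LR {suc p} _ p≤N lr = trans (precLRMax≡upTo p≤N) (trans (precLRMaxUpTo-suc ≤-refl) (if-T lr))

  precLRMax-suc : ∀ {p} → 1 ≤ p → suc p ≤ N → ¬ T (LR (suc p)) → Mx (suc p) ≡ Mx p
  precLRMax-suc {p} 1≤p sp≤N ¬lr = begin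
    Mx (suc p)                         ≡⟨ precLRMax≡upTo sp≤N ⟩
    precLRMaxUpTo (suc p) (suc p)      ≡⟨ precLRMaxUpTo-suc ≤-refl ⟩
    (if LR (suc p) then v (suc p) else precLRMaxUpTo (suc p) p)   ≡⟨ if-¬T ¬lr ⟩
    precLRMaxUpTo (suc p) p            ≡⟨ precLRMaxUpTo-irrelevant p 1≤p (n≤1+n p) ≤-refl ⟩
    precLRMaxUpTo p p                  ≡⟨ sym (precLRMax≡upTo (<⇒≤ sp≤N)) ⟩
    Mx p                               ∎
    where open ≡-Reasoning

  ¬isLRMax⇒pred-pos : ∀ {p} → ¬ T (LR (suc p)) → 1 ≤ p
  ¬isLRMax⇒pred-pos {zero}  ¬lr = ⊥-elim (¬lr isLRMax-1)
  ¬isLRMax⇒pred-pos {suc p} _   = s≤s z≤n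

  ≤-precLRMax : ∀ {p q} → 1 ≤ q → q ≤ p → p ≤ N → v q ≤ Mx p
  ≤-precLRMax {zero}  1≤q q≤0 _ = ⊥-elim (<⇒≱ 1≤q q≤0)
  ≤-precLRMax {suc p} {q} 1≤q q≤sp sp≤N with T? (LR (suc p))
  ... | yes lr = subst (v q ≤_) (sym (precLRMax-LR (s≤s z≤n) sp≤N lr)) (≤-LR (m≤n⇒m<n∨m≡n q≤sp))
    where
    ≤-LR : q < suc p ⊎ q ≡ suc p → v q ≤ v (suc p)
    ≤-LR (inj₁ q<sp) = <⇒≤ (isLRMax⇒< sp≤N lr 1≤q q<sp)
    ≤-LR (inj₂ refl) = ≤-refl
  ... | no ¬lr = subst (v q ≤_) (sym (precLRMax-suc (¬isLRMax⇒pred-pos ¬lr) sp≤N ¬lr)) (≤-nonLR (m≤n⇒m<n∨m≡n q≤sp))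
    where
    ≤-nonLR : q < suc p ⊎ q ≡ suc p → v q ≤ Mx p
    ≤-nonLR (inj₁ q<sp) = ≤-precLRMax 1≤q (≤-pred q<sp) (<⇒≤ sp≤N)
    ≤-nonLR (inj₂ refl) with r , 1≤r , r<sp , vq<vr ← ¬isLRMax⇒> 1≤q sp≤N ¬lr =
      <⇒≤ (<-≤-trans vq<vr (≤-precLRMax 1≤r (≤-pred r<sp) (<⇒≤ sp≤N)))

  precLRMax-attained : ∀ {p} → 1 ≤ p → p ≤ N → ∃ λ r → 1 ≤ r × r ≤ p × Mx p ≡ v r
  precLRMax-attained {suc p} _ sp≤N with T? (LR (suc p))
  ... | yes lr = suc p , s≤s z≤n , ≤-refl , precLRMax-LR (s≤s z≤n) sp≤N lr
  ... | no ¬lr with r , 1≤r , r≤p , Mx≡ ← precLRMax-attained (¬isLRMax⇒pred-pos ¬lr) (<⇒≤ sp≤N) =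
    r , 1≤r , m≤n⇒m≤1+n r≤p , trans (precLRMax-suc (¬isLRMax⇒pred-pos ¬lr) sp≤N ¬lr) Mx≡

  nonLRMax<precLRMax : ∀ {p} → 1 ≤ p → p ≤ N → ¬ T (LR p) → v p < Mx p
  nonLRMax<precLRMax {p} 1≤p p≤N ¬lr with r , 1≤r , r<p , vp<vr ← ¬isLRMax⇒> 1≤p p≤N ¬lr =
    <-≤-trans vp<vr (≤-precLRMax 1≤r (<⇒≤ r<p) p≤N)

  precLRMax<LRMax : ∀ {p} → 1 ≤ p → suc p ≤ N → T (LR (suc p)) → Mx p < v (suc p)
  precLRMax<LRMax {p} 1≤p sp≤N lr with r , 1≤r , r≤p , Mx≡ ← precLRMax-attained 1≤p (<⇒≤ sp≤N) =
    subst (_< v (suc p)) (sym Mx≡) (isLRMax⇒< sp≤N lr 1≤r (s≤s r≤p))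

  count : (ℕ → Bool) → ℕ
  count P = countB P (positions N)

  -- Opaque, so that unification treats these predicates as rigid instead of unfolding them.
  opaque
    below : ℕ → ℕ → ℕ → Bool
    below p x k = (p <ᵇ k) ∧ (v k <ᵇ x)

    window : ℕ → ℕ → ℕ → ℕ → Bool
    window p lo hi k = (p <ᵇ k) ∧ (lo <ᵇ v k) ∧ (v k <ᵇ hi)

    below⁺ : ∀ {p x k} → p < k → v k < x → T (below p x k)
    below⁺ p<k vk<x = <⇒<ᵇ p<k ∧ᵀ <⇒<ᵇ vk<x

    below⁻ : ∀ {p x k} → T (below p x k) → p < k × v k < x
    below⁻ {p} {x} {k} t with p<k , vk<x ← T-∧ .to t = <ᵇ⇒< p k p<k , <ᵇ⇒< (v k) x vk<x

    window⁺ : ∀ {p lo hi k} → p < k → lo < v k → v k < hi → T (window p lo hi k)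
    window⁺ p<k lo<vk vk<hi = <⇒<ᵇ p<k ∧ᵀ <⇒<ᵇ lo<vk ∧ᵀ <⇒<ᵇ vk<hi

    window⁻ : ∀ {p lo hi k} → T (window p lo hi k) → p < k × lo < v k × v k < hi
    window⁻ {p} {lo} {hi} {k} t with p<k , t′ ← T-∧ .to t with lo<vk , vk<hi ← T-∧ .to t′ =
      <ᵇ⇒< p k p<k , <ᵇ⇒< lo (v k) lo<vk , <ᵇ⇒< (v k) hi vk<hi

    height-LR : ∀ {p} → T (LR p) → H p ≡ count (below p (v p))
    height-LR = if-T

    height-¬LR : ∀ {p} → ¬ T (LR p) → H p ≡ count (window p (v p) (Mx p))
    height-¬LR = if-¬T

  below-next : ∀ {p k} → p < k → v k < v (suc p) → T (below (suc p) (v (suc p)) k)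
  below-next p<k vk<vsp = below⁺ (≤∧≢⇒< p<k λ { refl → <-irrefl refl vk<vsp }) vk<vsp

  height-≤-LRMax : ∀ {p} → 1 ≤ p → suc p ≤ N → T (LR (suc p)) → H p ≤ H (suc p)
  height-≤-LRMax {p} 1≤p sp≤N lr′ with T? (LR p)
  ... | yes lr = subst₂ _≤_ (sym (height-LR lr)) (sym (height-LR lr′))
    (countB-mono (positions N) λ _ t → let p<k , vk<vp = below⁻ t in
      below-next p<k (<-trans vk<vp (isLRMax⇒< sp≤N lr′ 1≤p ≤-refl)))
  ... | no ¬lr = subst₂ _≤_ (sym (height-¬LR ¬lr)) (sym (height-LR lr′))
    (countB-mono (positions N) λ _ t → let p<k , _ , vk<Mx = window⁻ t in
      below-next p<k (<-trans vk<Mx (precLRMax<LRMax 1≤p sp≤N lr′)))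

  count-split-at : ∀ {P A B : ℕ → Bool} {m} → 1 ≤ m → m ≤ N → T (P m) →
                   (∀ {k} → k ∈ positions N → T (P k) → k ≢ m → v k < v m → T (A k)) →
                   (∀ {k} → k ∈ positions N → T (P k) → k ≢ m → v m < v k → T (B k)) →
                   (∀ {k} → T (A k) → T (P k) × k ≢ m × v k < v m) →
                   (∀ {k} → T (B k) → T (P k) × k ≢ m × v m < v k) →
                   count P ≡ suc (count A + count B)
  count-split-at {P} {A} {B} {m} 1≤m m≤N Pm P⇒A P⇒B A⇒ B⇒ =
    trans (countB-insert (positions-unique N) (∈-positions⁺ 1≤m m≤N) Pm split shrink)
          (cong suc (countB-∨ (positions N) disjoint))
    where
    split : ∀ {k} → k ∈ positions N → T (P k) → k ≡ m ⊎ T (A k ∨ B k)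
    split {k} k∈ Pk with k ≟ m
    ... | yes k≡m = inj₁ k≡m
    ... | no  k≢m with val-<⊎> (proj₁ (∈-positions⁻ k∈)) (proj₂ (∈-positions⁻ k∈)) 1≤m m≤N k≢m
    ...   | inj₁ vk<vm = inj₂ (T-∨ .from (inj₁ (P⇒A k∈ Pk k≢m vk<vm)))
    ...   | inj₂ vm<vk = inj₂ (T-∨ .from (inj₂ (P⇒B k∈ Pk k≢m vm<vk)))
    shrink : ∀ {k} → T (A k ∨ B k) → T (P k) × k ≢ m
    shrink t with T-∨ .to t
    ... | inj₁ Ak = let Pk , k≢m , _ = A⇒ Ak in Pk , k≢m
    ... | inj₂ Bk = let Pk , k≢m , _ = B⇒ Bk in Pk , k≢m
    disjoint : ∀ {k} → T (A k) → ¬ T (B k)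
    disjoint Ak Bk = <-asym (proj₂ (proj₂ (A⇒ Ak))) (proj₂ (proj₂ (B⇒ Bk)))

  after-next : ∀ {p k} → p < k → k ≢ suc p → suc p < k
  after-next p<k k≢sp = ≤∧≢⇒< p<k (k≢sp ∘ sym)

  next≢ : ∀ {p k} → suc p < k → k ≢ suc p
  next≢ sp<k refl = <-irrefl refl sp<k

  height-≤-descent : ∀ {p} → 1 ≤ p → suc p ≤ N → ¬ T (LR p) → ¬ T (LR (suc p)) → v (suc p) < v p →
                     H p ≤ H (suc p)
  height-≤-descent {p} 1≤p sp≤N ¬lr ¬lr′ vsp<vp = subst₂ _≤_ (sym (height-¬LR ¬lr)) (sym (height-¬LR ¬lr′))
    (countB-mono (positions N) λ {k} _ t → let p<k , vp<vk , vk<Mx = window⁻ t in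
      window⁺ (≤∧≢⇒< p<k λ { refl → <-asym vsp<vp vp<vk }) (<-trans vsp<vp vp<vk)
              (subst (v k <_) (sym (precLRMax-suc 1≤p sp≤N ¬lr′)) vk<Mx))

  height-LRMax-drop : ∀ {p} → 1 ≤ p → suc p ≤ N → T (LR p) → ¬ T (LR (suc p)) →
                      H p ≡ suc (count (below (suc p) (v (suc p))) + H (suc p))
  height-LRMax-drop {p} 1≤p sp≤N lr ¬lr′ = begin
    H p
      ≡⟨ height-LR lr ⟩
    count (below p (v p))
      ≡⟨ count-split-at (s≤s z≤n) sp≤N (below⁺ ≤-refl vsp<vp) P⇒A P⇒B A⇒ B⇒ ⟩
    suc (count (below (suc p) (v (suc p))) + count upper)
      ≡⟨ cong (λ h → suc (count (below (suc p) (v (suc p))) + h)) (sym (height-¬LR ¬lr′)) ⟩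
    suc (count (below (suc p) (v (suc p))) + H (suc p))
      ∎
    where
    open ≡-Reasoning
    upper = window (suc p) (v (suc p)) (Mx (suc p))
    Mx≡vp : Mx (suc p) ≡ v p
    Mx≡vp = trans (precLRMax-suc 1≤p sp≤N ¬lr′) (precLRMax-LR 1≤p (<⇒≤ sp≤N) lr)
    vsp<vp : v (suc p) < v p
    vsp<vp = subst (v (suc p) <_) Mx≡vp (nonLRMax<precLRMax (s≤s z≤n) sp≤N ¬lr′)
    P⇒A : ∀ {k} → k ∈ positions N → T (below p (v p) k) → k ≢ suc p → v k < v (suc p) → T (below (suc p) (v (suc p)) k)
    P⇒A _ t k≢sp = below⁺ (after-next (proj₁ (below⁻ t)) k≢sp)
    P⇒B : ∀ {k} → k ∈ positions N → T (below p (v p) k) → k ≢ suc p → v (suc p) < v k → T (upper k)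
    P⇒B {k} _ t k≢sp vsp<vk with p<k , vk<vp ← below⁻ t =
      window⁺ (after-next p<k k≢sp) vsp<vk (subst (v k <_) (sym Mx≡vp) vk<vp)
    A⇒ : ∀ {k} → T (below (suc p) (v (suc p)) k) → T (below p (v p) k) × k ≢ suc p × v k < v (suc p)
    A⇒ t with sp<k , vk<vsp ← below⁻ t = below⁺ (<-trans (n<1+n p) sp<k) (<-trans vk<vsp vsp<vp) , next≢ sp<k , vk<vsp
    B⇒ : ∀ {k} → T (upper k) → T (below p (v p) k) × k ≢ suc p × v (suc p) < v k
    B⇒ {k} t with sp<k , vsp<vk , vk<Mx ← window⁻ t =
      below⁺ (<-trans (n<1+n p) sp<k) (subst (v k <_) Mx≡vp vk<Mx) , next≢ sp<k , vsp<vk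

  height-ascent : ∀ {p} → 1 ≤ p → suc p ≤ N → ¬ T (LR p) → ¬ T (LR (suc p)) → v p < v (suc p) →
                  H p ≡ suc (count (window (suc p) (v p) (v (suc p))) + H (suc p))
  height-ascent {p} 1≤p sp≤N ¬lr ¬lr′ vp<vsp = begin
    H p
      ≡⟨ height-¬LR ¬lr ⟩
    count (window p (v p) (Mx p))
      ≡⟨ count-split-at (s≤s z≤n) sp≤N (window⁺ ≤-refl vp<vsp vsp<Mx) P⇒A P⇒B A⇒ B⇒ ⟩
    suc (count (window (suc p) (v p) (v (suc p))) + count upper)
      ≡⟨ cong (λ h → suc (count (window (suc p) (v p) (v (suc p))) + h)) (sym (height-¬LR ¬lr′)) ⟩
    suc (count (window (suc p) (v p) (v (suc p))) + H (suc p))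
      ∎
    where
    open ≡-Reasoning
    upper = window (suc p) (v (suc p)) (Mx (suc p))
    Mx≡ : Mx (suc p) ≡ Mx p
    Mx≡ = precLRMax-suc 1≤p sp≤N ¬lr′
    vsp<Mx : v (suc p) < Mx p
    vsp<Mx = subst (v (suc p) <_) Mx≡ (nonLRMax<precLRMax (s≤s z≤n) sp≤N ¬lr′)
    P⇒A : ∀ {k} → k ∈ positions N → T (window p (v p) (Mx p) k) → k ≢ suc p → v k < v (suc p) →
          T (window (suc p) (v p) (v (suc p)) k)
    P⇒A _ t k≢sp with p<k , vp<vk , _ ← window⁻ t = window⁺ (after-next p<k k≢sp) vp<vk
    P⇒B : ∀ {k} → k ∈ positions N → T (window p (v p) (Mx p) k) → k ≢ suc p → v (suc p) < v k → T (upper k)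
    P⇒B {k} _ t k≢sp vsp<vk with p<k , _ , vk<Mx ← window⁻ t =
      window⁺ (after-next p<k k≢sp) vsp<vk (subst (v k <_) (sym Mx≡) vk<Mx)
    A⇒ : ∀ {k} → T (window (suc p) (v p) (v (suc p)) k) → T (window p (v p) (Mx p) k) × k ≢ suc p × v k < v (suc p)
    A⇒ t with sp<k , vp<vk , vk<vsp ← window⁻ t =
      window⁺ (<-trans (n<1+n p) sp<k) vp<vk (<-trans vk<vsp vsp<Mx) , next≢ sp<k , vk<vsp
    B⇒ : ∀ {k} → T (upper k) → T (window p (v p) (Mx p) k) × k ≢ suc p × v (suc p) < v k
    B⇒ {k} t with sp<k , vsp<vk , vk<Mx ← window⁻ t =
      window⁺ (<-trans (n<1+n p) sp<k) (<-trans vp<vsp vsp<vk) (subst (v k <_) Mx≡ vk<Mx) , next≢ sp<k , vsp<vk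

  height-decrease⇒¬LRMax : ∀ {p} → 1 ≤ p → suc p ≤ N → H (suc p) < H p → ¬ T (LR (suc p))
  height-decrease⇒¬LRMax 1≤p sp≤N H< lr′ = <⇒≱ H< (height-≤-LRMax 1≤p sp≤N lr′)

  height-decrease⇒ascent : ∀ {p} → 1 ≤ p → suc p ≤ N → ¬ T (LR p) → H (suc p) < H p → v p < v (suc p)
  height-decrease⇒ascent {p} 1≤p sp≤N ¬lr H< with val-<⊎> 1≤p (<⇒≤ sp≤N) (s≤s z≤n) sp≤N (<⇒≢ (n<1+n p))
  ... | inj₁ vp<vsp = vp<vsp
  ... | inj₂ vsp<vp = ⊥-elim (<⇒≱ H< (height-≤-descent 1≤p sp≤N ¬lr (height-decrease⇒¬LRMax 1≤p sp≤N H<) vsp<vp))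


truncated-bound-absurd : ∀ {h s c d b i} → h ≤ s + c → c + suc i ≡ d + b → i < b → b ≤ i + (h ∸ d ∸ s) → ⊥
truncated-bound-absurd {h} {s} {c} {d} {b} {i} h≤s+c c+1+i≡d+b i<b b≤ = 1+n≰n (begin
  suc (h + i)         ≡⟨ sym (+-suc h i) ⟩
  h + suc i           ≤⟨ +-monoˡ-≤ (suc i) h≤s+c ⟩
  s + c + suc i       ≡⟨ trans (+-assoc s c (suc i)) (cong (s +_) c+1+i≡d+b) ⟩
  s + (d + b)         ≤⟨ +-monoʳ-≤ s (+-monoʳ-≤ d b≤) ⟩
  s + (d + (i + X))   ≡⟨ rearrange s d i X ⟩
  d + s + X + i       ≡⟨ cong (λ y → d + s + y + i) (∸-+-assoc h d s) ⟩
  d + s + (h ∸ (d + s)) + i  ≡⟨ cong (_+ i) (m+[n∸m]≡n d+s≤h) ⟩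
  h + i               ∎)
  where
  open ≤-Reasoning
  X = h ∸ d ∸ s
  rearrange : ∀ s d i X → s + (d + (i + X)) ≡ d + s + X + i
  rearrange = solve-∀
  d+s≤h : d + s ≤ h
  d+s≤h = <⇒≤ (m∸n≢0⇒n<m λ X≡0 →
    <⇒≱ i<b (≤-trans b≤ (≤-reflexive (trans (cong (i +_) (trans (∸-+-assoc h d s) X≡0)) (+-identityʳ i)))))

module AfterFirstJump (ρ : List ℕ) (ρ-unique : Unique ρ) {i d l : ℕ}
  (1≤i : 1 ≤ i) (i<N : i < len ρ) (i+l≤N : i + l ≤ len ρ)
  (jump : height ρ i ≡ suc (height ρ (suc i)) + d)
  (no-jump-before : ∀ {p} → 1 ≤ p → p < i → height ρ p ≤ suc (height ρ (suc p)))
  (run : ∀ {k} → i < k → k < i + l → height ρ k ≡ suc (height ρ (suc k)))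
  where

  open Entries ρ ρ-unique

  depth-from-drop : ∀ {c} → H i ≡ suc (c + H (suc i)) → d ≡ c
  depth-from-drop {c} H≡ =
    +-cancelˡ-≡ (H (suc i)) d c (trans (suc-injective (trans (sym jump) H≡)) (+-comm c (H (suc i))))

  next<height : H (suc i) < H i
  next<height = subst (H (suc i) <_) (sym jump) (s≤s (m≤m+n (H (suc i)) d))

  next-¬LRMax : ¬ T (LR (suc i))
  next-¬LRMax = height-decrease⇒¬LRMax 1≤i i<N next<height

  empty-before-jump : ∀ {q X k} → 1 ≤ q → q < i → H q ≡ suc (count X + H (suc q)) → k ∈ positions N → ¬ T (X k)
  empty-before-jump {q} {X} 1≤q q<i Hq≡ k∈ Xk = <⇒≱ (begin-strict
    suc (H (suc q))                 <⟨ s≤s (+-monoˡ-≤ (H (suc q)) (countB-pos (positions N) k∈ Xk)) ⟩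
    suc (count X + H (suc q))       ≡⟨ sym Hq≡ ⟩
    H q                             ∎) (no-jump-before 1≤q q<i)
    where open ≤-Reasoning

  -- Such an entry would lie in the extra set of the drop h_q - h_{q+1} - 1 (the entries below
  -- ρ_{q+1} if q is a left-to-right maximum, else the gap between ρ_q and ρ_{q+1}), which is
  -- empty before the jump.
  smaller-later-contradiction : ∀ {q k} → 1 ≤ q → q < i → ¬ T (LR (suc q)) → (¬ T (LR q) → v q < v k) →
                                i < k → k ≤ N → ¬ v k < v (suc q)
  smaller-later-contradiction {q} {k} 1≤q q<i ¬lr ih i<k k≤N vk<vsq = case T? (LR q) of λ
    { (yes lr)  → empty-before-jump 1≤q q<i (height-LRMax-drop 1≤q sq≤N lr ¬lr) k∈ (below⁺ sq<k vk<vsq)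
    ; (no ¬lr′) → empty-before-jump 1≤q q<i (height-ascent 1≤q sq≤N ¬lr′ ¬lr (<-trans (ih ¬lr′) vk<vsq)) k∈
                                    (window⁺ sq<k (ih ¬lr′) vk<vsq)
    }
    where
    sq≤N = ≤-trans q<i (<⇒≤ i<N)
    sq<k = ≤-<-trans q<i i<k
    k∈ = ∈-positions⁺ (≤-trans (s≤s z≤n) i<k) k≤N

  nonLRMax<later : ∀ {p k} → 1 ≤ p → p ≤ i → ¬ T (LR p) → i < k → k ≤ N → v p < v k
  nonLRMax<later {suc zero} _ _ ¬lr _ _ = ⊥-elim (¬lr isLRMax-1)
  nonLRMax<later {suc (suc q)} 1≤p p≤i ¬lr i<k k≤N =
    val-≮⇒> 1≤p (≤-trans p≤i (<⇒≤ i<N)) (≤-trans (s≤s z≤n) i<k) k≤N (<⇒≢ (≤-<-trans p≤i i<k))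
      (smaller-later-contradiction (s≤s z≤n) p≤i ¬lr
        (λ ¬lr′ → nonLRMax<later (s≤s z≤n) (<⇒≤ p≤i) ¬lr′ i<k k≤N) i<k k≤N)

  depth≡count-below-next : d ≡ count (below (suc i) (v (suc i)))
  depth≡count-below-next with T? (LR i)
  ... | yes lr = depth-from-drop (height-LRMax-drop 1≤i i<N lr next-¬LRMax)
  ... | no ¬lr = trans (depth-from-drop (height-ascent 1≤i i<N ¬lr next-¬LRMax vi<vsi))
                       (countB-cong (positions N)
                         (λ _ t → let si<k , _ , vk<vsi = window⁻ t in below⁺ si<k vk<vsi)
                         (λ k∈ t → let si<k , vk<vsi = below⁻ t in window⁺ si<k (vi<later k∈ si<k) vk<vsi))
    where
    vi<vsi : v i < v (suc i)
    vi<vsi = height-decrease⇒ascent 1≤i i<N ¬lr next<height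
    vi<later : ∀ {k} → k ∈ positions N → suc i < k → v i < v k
    vi<later k∈ si<k = nonLRMax<later 1≤i ≤-refl ¬lr (<-trans (n<1+n i) si<k) (proj₂ (∈-positions⁻ k∈))

  run-decrease : ∀ {b} → i < b → suc b ≤ i + l → H (suc b) < H b
  run-decrease {b} i<b sb≤i+l = subst (H (suc b) <_) (sym (run i<b sb≤i+l)) (n<1+n (H (suc b)))

  run-¬LRMax : ∀ {b} → i < b → b ≤ i + l → ¬ T (LR b)
  run-¬LRMax {suc b} (s≤s i≤b) sb≤i+l with m≤n⇒m<n∨m≡n i≤b
  ... | inj₂ refl = next-¬LRMax
  ... | inj₁ i<b  = height-decrease⇒¬LRMax (≤-trans (s≤s z≤n) i<b) (≤-trans sb≤i+l i+l≤N) (run-decrease i<b sb≤i+l)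

  run-ascent : ∀ {b} → i < b → suc b ≤ i + l → v b < v (suc b)
  run-ascent i<b sb≤i+l = height-decrease⇒ascent (≤-trans (s≤s z≤n) i<b) (≤-trans sb≤i+l i+l≤N)
                            (run-¬LRMax i<b (<⇒≤ sb≤i+l)) (run-decrease i<b sb≤i+l)

  run-no-gap : ∀ {b} → i < b → suc b ≤ i + l → count (window (suc b) (v b) (v (suc b))) ≡ 0
  run-no-gap {b} i<b sb≤i+l = +-cancelʳ-≡ (H (suc b)) _ 0 (suc-injective (trans (sym ascent) (run i<b sb≤i+l)))
    where
    sb≤N = ≤-trans sb≤i+l i+l≤N
    ascent = height-ascent (≤-trans (s≤s z≤n) i<b) sb≤N (run-¬LRMax i<b (<⇒≤ sb≤i+l))
               (height-decrease⇒¬LRMax (≤-trans (s≤s z≤n) i<b) sb≤N (run-decrease i<b sb≤i+l)) (run-ascent i<b sb≤i+l)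

  run-monotone : ∀ {k b} → i < k → k ≤ b → b ≤ i + l → v k ≤ v b
  run-monotone {k} {b} i<k k≤b b≤i+l with m≤n⇒m<n∨m≡n k≤b
  ... | inj₂ refl = ≤-refl
  run-monotone {k} {suc b} i<k _ sb≤i+l | inj₁ (s≤s k≤b) =
    ≤-trans (run-monotone i<k k≤b (<⇒≤ sb≤i+l)) (<⇒≤ (run-ascent (<-≤-trans i<k k≤b) sb≤i+l))

  run-count-below : ∀ {b} → i < b → b ≤ i + l → count (below i (v b)) + suc i ≡ d + b
  run-count-below {suc b} (s≤s i≤b) sb≤i+l with m≤n⇒m<n∨m≡n i≤b
  ... | inj₂ refl = cong (_+ suc i) (trans
          (countB-cong (positions N) (λ _ t → let i<k , vk<vsi = below⁻ t in below-next i<k vk<vsi)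
                                     (λ _ t → let si<k , vk<vsi = below⁻ t in below⁺ (<-trans (n<1+n i) si<k) vk<vsi))
          (sym depth≡count-below-next))
  ... | inj₁ i<b = begin
    count (below i (v (suc b))) + suc i    ≡⟨ cong (_+ suc i) grow ⟩
    suc (count (below i (v b)) + suc i)    ≡⟨ cong suc (run-count-below i<b (<⇒≤ sb≤i+l)) ⟩
    suc (d + b)                            ≡⟨ sym (+-suc d b) ⟩
    d + suc b                              ∎
    where
    open ≡-Reasoning
    1≤b = ≤-trans (s≤s z≤n) i<b
    b≤N = ≤-trans (<⇒≤ sb≤i+l) i+l≤N
    vb<vsb = run-ascent i<b sb≤i+l
    no-value-between : ∀ {k} → k ∈ positions N → T (below i (v (suc b)) k) → k ≢ b → v b < v k → T false
    no-value-between {k} k∈ t k≢b vb<vk with i<k , vk<vsb ← below⁻ t | <-cmp k (suc b)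
    ... | tri< k<sb _ _ = <⇒≱ vb<vk (run-monotone i<k (≤-pred k<sb) (<⇒≤ sb≤i+l))
    ... | tri≈ _ refl _ = <-irrefl refl vk<vsb
    ... | tri> _ _ sb<k = <⇒≢ (countB-pos (positions N) k∈ (window⁺ sb<k vb<vk vk<vsb)) (sym (run-no-gap i<b sb≤i+l))
    grow : count (below i (v (suc b))) ≡ suc (count (below i (v b)))
    grow = trans (count-split-at 1≤b b≤N (below⁺ i<b vb<vsb)
                    (λ _ t _ vk<vb → below⁺ (proj₁ (below⁻ t)) vk<vb)
                    no-value-between
                    (λ t → let i<k , vk<vb = below⁻ t in
                       below⁺ i<k (<-trans vk<vb vb<vsb) , (λ { refl → <-irrefl refl vk<vb }) , vk<vb)
                    (λ ()))
                 (cong suc (trans (cong (count (below i (v b)) +_) (countB-≡0 (positions N) (λ _ ()))) (+-identityʳ _)))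

  nonLRMaxAfter : ℕ → ℕ → Bool
  nonLRMaxAfter a p = (a <ᵇ p) ∧ not (LR p)

  LRMax-height-≤ : ∀ {a b} → 1 ≤ a → a ≤ i → T (LR a) → i < b → b ≤ N → v a < v b →
                   H a ≤ countB (nonLRMaxAfter a) (positions i) + count (below i (v b))
  LRMax-height-≤ {a} {b} 1≤a a≤i lr i<b b≤N va<vb = begin
    H a                                                            ≡⟨ height-LR lr ⟩
    count (below a (v a))                                          ≤⟨ countB-mono (positions N) before-or-after ⟩
    count (λ k → (nonLRMaxAfter a k ∧ (k ≤ᵇ i)) ∨ below i (v b) k)  ≡⟨ countB-∨ (positions N) disjoint ⟩
    count (λ k → nonLRMaxAfter a k ∧ (k ≤ᵇ i)) + count (below i (v b))
      ≡⟨ cong (_+ count (below i (v b))) (countB-positions-∧≤ (nonLRMaxAfter a) (<⇒≤ i<N)) ⟩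
    countB (nonLRMaxAfter a) (positions i) + count (below i (v b)) ∎
    where
    open ≤-Reasoning
    before-or-after : ∀ {k} → k ∈ positions N → T (below a (v a) k) →
                      T ((nonLRMaxAfter a k ∧ (k ≤ᵇ i)) ∨ below i (v b) k)
    before-or-after {k} k∈ t with a<k , vk<va ← below⁻ t | k ≤? i
    ... | yes k≤i = T-∨ .from (inj₁ ((<⇒<ᵇ a<k ∧ᵀ T-not-≡ .from (¬T⇒≡false ¬lr)) ∧ᵀ ≤⇒≤ᵇ k≤i))
      where ¬lr = λ lr′ → <-asym vk<va (isLRMax⇒< (proj₂ (∈-positions⁻ k∈)) lr′ 1≤a a<k)
    ... | no k≰i = T-∨ .from (inj₂ (below⁺ (≰⇒> k≰i) (<-trans vk<va va<vb)))
    disjoint : ∀ {k} → T (nonLRMaxAfter a k ∧ (k ≤ᵇ i)) → ¬ T (below i (v b) k)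
    disjoint {k} t t′ = <⇒≱ (proj₁ (below⁻ t′)) (≤ᵇ⇒≤ k i (proj₂ (T-∧ .to t)))

  LRMax-above-run : ∀ {a b} → 1 ≤ a → a ≤ i → T (LR a) → i < b → b ≤ i + l →
                    b ≤ i + (H a ∸ d ∸ countB (nonLRMaxAfter a) (positions i)) → v b < v a
  LRMax-above-run 1≤a a≤i lr i<b b≤i+l b≤ =
    val-≮⇒> (≤-trans (s≤s z≤n) i<b) b≤N 1≤a (≤-trans a≤i (<⇒≤ i<N)) (>⇒≢ (≤-<-trans a≤i i<b)) λ va<vb →
      truncated-bound-absurd (LRMax-height-≤ 1≤a a≤i lr i<b b≤N va<vb) (run-count-below i<b b≤i+l) i<b b≤
    where b≤N = ≤-trans b≤i+l i+l≤N

  a : ℕ → ℕ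
  a = ix ρ i d l

  bnd : ℕ → ℕ
  bnd = bound ρ i d l

  LRMax-index : ∀ {g} → 1 ≤ g → g ≤ r ρ i d l → 1 ≤ a g × a g ≤ i × T (LR (a g))
  LRMax-index 1≤g g≤r with a∈ , lr ← filterB⁻ (positions i) (at-∈ (lrMaxima ρ i d l) 1≤g g≤r) =
    proj₁ (∈-positions⁻ a∈) , proj₂ (∈-positions⁻ a∈) , lr

  inRange : ℕ → ℕ → Bool
  inRange g b = (i <ᵇ b) ∧ (b ≤ᵇ i + bnd g)

  occurrence : ℕ → ℕ → ℕ → Bool
  occurrence g b k = (i <ᵇ b) ∧ (b ≤ᵇ i + bnd g) ∧ (i <ᵇ k) ∧ (v k <ᵇ v (suc i)) ∧ isOcc321 ρ i d l (a g) b k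

  occurrence⁻ : ∀ {g b k} → T (occurrence g b k) → T (inRange g b) × b < k × v k < v (suc i)
  occurrence⁻ {g} {b} {k} t
    with i<b , t₁ ← T-∧ {i <ᵇ b} .to t
    with b≤ , t₂ ← T-∧ {b ≤ᵇ i + bnd g} .to t₁
    with _ , t₃ ← T-∧ {i <ᵇ k} .to t₂
    with vk<vsi , t₄ ← T-∧ {v k <ᵇ v (suc i)} .to t₃
    with _ , t₅ ← T-∧ {a g <ᵇ b} .to t₄
    with b<k , _ ← T-∧ {b <ᵇ k} .to t₅ =
    i<b ∧ᵀ b≤ , <ᵇ⇒< b k b<k , <ᵇ⇒< (v k) (v (suc i)) vk<vsi

  occurrences-in-range : ∀ {g b} → 1 ≤ g → g ≤ r ρ i d l → T (inRange g b) →
                         countB (occurrence g b) (positions N) ≡ d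
  occurrences-in-range {g} {b} 1≤g g≤r t = trans (countB-cong (positions N) occurrence⇒ ⇒occurrence) (sym depth≡count-below-next)
    where
    i<b = <ᵇ⇒< i b (proj₁ (T-∧ .to t))
    b≤i+bnd = ≤ᵇ⇒≤ b (i + bnd g) (proj₂ (T-∧ .to t))
    b≤i+l = ≤-trans b≤i+bnd (+-monoʳ-≤ i (m⊓n≤n _ l))
    index = LRMax-index 1≤g g≤r
    occurrence⇒ : ∀ {k} → k ∈ positions N → T (occurrence g b k) → T (below (suc i) (v (suc i)) k)
    occurrence⇒ _ t with _ , b<k , vk<vsi ← occurrence⁻ t = below⁺ (≤-<-trans i<b b<k) vk<vsi
    ⇒occurrence : ∀ {k} → k ∈ positions N → T (below (suc i) (v (suc i)) k) → T (occurrence g b k)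
    ⇒occurrence {k} _ t′ with si<k , vk<vsi ← below⁻ t′ =
      <⇒<ᵇ i<b ∧ᵀ ≤⇒≤ᵇ b≤i+bnd ∧ᵀ <⇒<ᵇ (<-trans (n<1+n i) si<k) ∧ᵀ <⇒<ᵇ vk<vsi ∧ᵀ
      <⇒<ᵇ (≤-<-trans (proj₁ (proj₂ index)) i<b) ∧ᵀ <⇒<ᵇ b<k ∧ᵀ <⇒<ᵇ (<-≤-trans vk<vsi vsi≤vb) ∧ᵀ
      <⇒<ᵇ (LRMax-above-run (proj₁ index) (proj₁ (proj₂ index)) (proj₂ (proj₂ index)) i<b b≤i+l
              (≤-trans b≤i+bnd (+-monoʳ-≤ i (m⊓n≤m _ l))))
      where
      vsi≤vb = run-monotone (n<1+n i) i<b b≤i+l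
      b<k = ≰⇒> λ k≤b → <⇒≱ vk<vsi (run-monotone (n<1+n i) (<⇒≤ si<k) (≤-trans k≤b b≤i+l))

  occurrences-at : ∀ {g} b → 1 ≤ g → g ≤ r ρ i d l →
                   countB (occurrence g b) (positions N) ≡ (if inRange g b then d else 0)
  occurrences-at {g} b 1≤g g≤r with T? (inRange g b)
  ... | yes in-range = trans (occurrences-in-range {b = b} 1≤g g≤r in-range) (sym (if-T in-range))
  ... | no  outside  = trans (countB-≡0 (positions N) λ {k} _ t → outside (proj₁ (occurrence⁻ {g} {b} {k} t)))
                             (sym (if-¬T outside))

  occurrences-for : ∀ {g} → 1 ≤ g → g ≤ r ρ i d l →
                    sum (map (λ b → countB (occurrence g b) (positions N)) (positions N)) ≡ d * bnd g
  occurrences-for {g} 1≤g g≤r = begin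
    sum (map (λ b → countB (occurrence g b) (positions N)) (positions N))
      ≡⟨ sum-map-cong (positions N) (λ {b} _ → occurrences-at b 1≤g g≤r) ⟩
    sum (map (λ b → if inRange g b then d else 0) (positions N))
      ≡⟨ sum-map-indicator d (inRange g) (positions N) ⟩
    d * countB (inRange g) (positions N)
      ≡⟨ cong (d *_) (countB-interval i (bnd g) (≤-trans (+-monoʳ-≤ i (m⊓n≤n _ l)) i+l≤N)) ⟩
    d * bnd g ∎
    where open ≡-Reasoning

  formOccurrences≡ : ∀ {x} → 1 ≤ x → formOccurrences ρ i d l x ≡ d * sum (map bnd (fromTo x (r ρ i d l)))
  formOccurrences≡ {x} 1≤x = trans
    (sum-map-cong (fromTo x (r ρ i d l)) λ g∈ → let x≤g , g≤r = fromTo⁻ g∈ in occurrences-for (≤-trans 1≤x x≤g) g≤r)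
    (sum-map-*ˡ d bnd (fromTo x (r ρ i d l)))

mainTheorem4 : (n : ℕ) (ρ : List ℕ) → ρ ↭ map suc (upTo n) →
    (i d l : ℕ) → FirstJump ρ i d → ConsecutiveAfter ρ i l →
    (x : ℕ) → IsSmallestPositive ρ i d l x →
    formOccurrences ρ i d l x ≡ d * sum (map (bound ρ i d l) (fromTo x (r ρ i d l)))
mainTheorem4 n ρ ρ↭ i d l (jumpAt@(1≤i , i<N , _) , no-earlier-jump) (_ , i+l≤N , consecutive , _) x (1≤x , _) =
  formOccurrences≡ 1≤x
  where
  open AfterFirstJump ρ (permutation-unique ρ↭) 1≤i i<N i+l≤N (JumpAt⇒height ρ jumpAt)
    (λ {p} 1≤p p<i → noJump⇒height-≤ ρ 1≤p (<-trans p<i i<N) (no-earlier-jump p p<i))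
    (λ {k} i<k k<i+l → emptySegment⇒height ρ (≤-trans (s≤s z≤n) i<k) (<-≤-trans k<i+l i+l≤N) (consecutive k i<k k<i+l))
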